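{- Let $\mathcal{A}=(Q,\iota,\delta,F)$ be a reduced tree automaton over $\Sigma$, $n=|Q|$, and $L$ the language recognised by $\mathcal{A}$. The following are equivalent: (1) $L$ is fat; (2) there is a tree $t\in L$ with thickness greater than $2^{n-1}$; (3) the graph $G_{\mathcal{A}}$ contains a cycle which includes a special edge and from which some state of $F$ is reachable.
   Context: A tree domain is a non-empty finite prefix-closed $D\subseteq\{0,1\}^\star$ with $u0\in D$ iff $u1\in D$ for all $u\in D$; a tree over the finite alphabet $\Sigma$ is a map $t\colon D\to\Sigma$ on a tree domain $D=\operatorname{dom}(t)$; $T_\Sigma$ is the set of trees. The thickness of $t$ is $\max_{\ell\ge0}|\operatorname{dom}(t)\cap\{0,1\}^\ell|$; a language $L\subseteq T_\Sigma$ is fat if there is no $K\ge1$ bounding the thickness of all its members. A tree automaton $\mathcal{A}=(Q,\iota,\delta,F)$ has finite $Q$, $\iota\colon\Sigma\to Q$, $\delta\colon\Sigma\times Q\times Q\to Q$, $F\subseteq Q$, and assigns $\mathcal{A}(t)=\iota(t(\epsilon))$ if $\operatorname{dom}(t)=\{\epsilon\}$ and $\mathcal{A}(t)=\delta(t(\epsilon),\mathcal{A}(t\restriction0),\mathcal{A}(t\restriction1))$ otherwise ($t\restriction u$ is the subtree $v\mapsto t(uv)$); it recognises $\{t:\mathcal{A}(t)\in F\}$ and is reduced if every state equals $\mathcal{A}(t)$ for some $t$. $G_{\mathcal{A}}=(Q,E_{\mathcal{A}})$ is the directed graph with $(p,q)\in E_{\mathcal{A}}$ iff there exist $a\in\Sigma$,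 $r\in Q$ with $\delta(a,p,r)=q$ or $\delta(a,r,p)=q$. An edge $(p,q)\in E_{\mathcal{A}}$ is special if such $a,r$ can be chosen with $r$ satisfying: there are infinitely many trees $t$ with $\mathcal{A}(t)=r$ (equivalently, $G_{\mathcal{A}}$ contains a cycle from which $r$ is reachable). -}

module Defs where

open import Data.Nat using (ℕ; zero; suc; _+_; _⊔_; _≤_; _<_; _^_; _∸_)
open import Data.Fin using (Fin)
open import Data.Fin.Subset using (Subset; _∈_)
open import Data.List using (List)
import Data.List.Membership.Propositional as LM
open import Data.Product using (Σ; ∃; ∃-syntax; _×_)
open import Data.Sum using (_⊎_)
open import Relation.Nullary using (¬_)
open import Relation.Binary.PropositionalEquality using (_≡_)
open import Relation.Binary.Construct.Closure.ReflexiveTransitive using (Star)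

-- A tree t : dom(t) → Σ on a tree domain dom(t) ⊆ {0,1}* corresponds exactly
-- to an element of this inductive type (node a l r has t(ε)=a, t↾0 = l, t↾1 = r).
data Tree (Σ′ : Set) : Set where
  leaf : Σ′ → Tree Σ′
  node : Σ′ → Tree Σ′ → Tree Σ′ → Tree Σ′

module _ {Σ′ : Set} where

  level : Tree Σ′ → ℕ → ℕ
  level (leaf _)     zero    = 1
  level (leaf _)     (suc ℓ) = 0
  level (node _ l r) zero    = 1
  level (node _ l r) (suc ℓ) = level l ℓ + level r ℓ

  height : Tree Σ′ → ℕ
  height (leaf _)     = 0
  height (node _ l r) = suc (height l ⊔ height r)

  maxLevel : Tree Σ′ → ℕ → ℕ
  maxLevel t zero    = level t zero
  maxLevel t (suc k) = maxLevel t k ⊔ level t (suc k)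

  -- thickness t = max_{ℓ ≥ 0} |dom(t) ∩ {0,1}^ℓ|  (levels beyond the height are empty)
  thickness : Tree Σ′ → ℕ
  thickness t = maxLevel t (height t)

  Fat : (Tree Σ′ → Set) → Set
  Fat L = ¬ (Σ ℕ λ K → 1 ≤ K × (∀ t → L t → thickness t ≤ K))

  Infinite : (Tree Σ′ → Set) → Set
  Infinite P = ¬ (Σ (List (Tree Σ′)) λ xs → ∀ t → P t → t LM.∈ xs)

record Automaton (s n : ℕ) : Set where
  field
    ι : Fin s → Fin n
    δ : Fin s → Fin n → Fin n → Fin n
    F : Subset n

module _ {s n : ℕ} (A : Automaton s n) where
  open Automaton A

  run : Tree (Fin s) → Fin n
  run (leaf a)     = ι a
  run (node a l r) = δ a (run l) (run r)

  Reduced : Set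
  Reduced = ∀ (q : Fin n) → ∃[ t ] run t ≡ q

  Lang : Tree (Fin s) → Set
  Lang t = run t ∈ F

  Edge : Fin n → Fin n → Set
  Edge p q = ∃[ a ] ∃[ r ] (δ a p r ≡ q ⊎ δ a r p ≡ q)

  InfRun : Fin n → Set
  InfRun r = Infinite (λ t → run t ≡ r)

  Special : Fin n → Fin n → Set
  Special p q = ∃[ a ] ∃[ r ] ((δ a p r ≡ q ⊎ δ a r p ≡ q) × InfRun r)

  Reach : Fin n → Fin n → Set
  Reach = Star Edge

  -- G_A has a cycle containing a special edge (p,q) (i.e. a path q →* p closing it)
  -- from which some state f ∈ F is reachable
  SpecialCycleToF : Set
  SpecialCycleToF = ∃[ p ] ∃[ q ] ∃[ f ] (Special p q × Reach q p × f ∈ F × Reach p f)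

  ThickWitness : Set
  ThickWitness = ∃[ t ] (Lang t × 2 ^ (n ∸ 1) < thickness t)

-- If no special cycle reaches the root state of a run, then wherever the root state recurs inside
-- one child, the sibling's state has finitely many runs, so no cycle reaches it and the sibling is
-- shorter than its number of distinct states; a child in which the root state does not recur has
-- strictly fewer distinct states, so induction on the tree bounds every level by 2 ^ (k ∸ 1), where
-- k ≤ n is the number of distinct states in the run. Conversely, a special edge (p, q) with sibling
-- state r, closed by a path q ⇝ p, is pumped: a q-run is grafted back along the path and set beside
-- a tall r-run, so a deep level gains a position per round, and continuing to an accepting state
-- yields accepted trees of any thickness. Fatness gives (3) by contradiction, which is constructive
-- since (3) is decidable: a state has infinitely many runs iff a cycle reaches it.
module Submission where

open import Defs
open import Data.Nat using (ℕ; zero; suc; _+_; _*_; _⊔_; _≤_; _<_; _^_; _∸_; z≤n; s≤s; _≤?_)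
open import Data.Nat.Properties hiding (_≟_)
open import Data.Fin using (Fin; zero; suc; _≟_)
open import Data.Fin.Properties using (any?)
open import Data.Fin.Subset using (Subset; _∈_; _⊆_; ⁅_⁆; _∪_; ∣_∣)
open import Data.Fin.Subset.Properties
  using (_∈?_; _⊂?_; ∣p∣≤n; p⊂q⇒∣p∣<∣q∣; p⊆q⇒∣p∣≤∣q∣; x∈⁅x⁆; x∈⁅y⁆⇒x≡y; ∣⁅x⁆∣≡1; x∈p∪q⁺; x∈p∪q⁻)
open import Data.Vec.Base using ([]; _∷_; here; there)
open import Data.List.Base using (List; []; _∷_; map; _++_; cartesianProduct; cartesianProductWith; allFin)
open import Data.List.Membership.Propositional using () renaming (_∈_ to _∈ₗ_)
open import Data.List.Membership.Propositional.Properties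
  using (∈-map⁺; ∈-++⁺ˡ; ∈-++⁺ʳ; ∈-cartesianProduct⁺; ∈-cartesianProductWith⁺; ∈-allFin)
open import Data.List.Relation.Unary.Any using (here; there)
open import Data.Product using (∃-syntax; _×_; _,_; proj₁; proj₂; uncurry)
open import Data.Sum using (_⊎_; inj₁; inj₂)
open import Data.Empty using (⊥-elim)
open import Function.Base using (_∘_)
open import Function.Bundles using (_⇔_; mk⇔)
open import Relation.Nullary using (¬_; Dec; yes; no; does; contradiction)
open import Relation.Nullary.Decidable using (_×-dec_; _⊎-dec_; map′; decidable-stable)
open import Relation.Binary.PropositionalEquality using (_≡_; refl; sym; trans; cong; cong₂; subst)
open import Relation.Binary.Construct.Closure.ReflexiveTransitive using (Star; ε; _◅_; _◅◅_)

module _ {S : Set} where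

  open ≤-Reasoning

  level-≡0 : ∀ (t : Tree S) {ℓ} → height t < ℓ → level t ℓ ≡ 0
  level-≡0 (leaf a)     {suc ℓ} _       = refl
  level-≡0 (node a l r) {suc ℓ} (s≤s h) =
    cong₂ _+_ (level-≡0 l (≤-<-trans (m≤m⊔n _ _) h)) (level-≡0 r (≤-<-trans (m≤n⊔m _ _) h))

  level-pos : ∀ (t : Tree S) {ℓ} → ℓ ≤ height t → 0 < level t ℓ
  level-pos (leaf a)     {zero}  _       = ≤-refl
  level-pos (node a l r) {zero}  _       = ≤-refl
  level-pos (node a l r) {suc ℓ} (s≤s h) with ≤-total (height l) (height r)
  ... | inj₁ hl≤hr = ≤-trans (level-pos r (subst (ℓ ≤_) (m≤n⇒m⊔n≡n hl≤hr) h)) (m≤n+m _ _)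
  ... | inj₂ hr≤hl = ≤-trans (level-pos l (subst (ℓ ≤_) (m≥n⇒m⊔n≡m hr≤hl) h)) (m≤m+n _ _)

  level≤2^ : ∀ (t : Tree S) ℓ → level t ℓ ≤ 2 ^ ℓ
  level≤2^ (leaf a)     zero    = ≤-refl
  level≤2^ (leaf a)     (suc ℓ) = z≤n
  level≤2^ (node a l r) zero    = ≤-refl
  level≤2^ (node a l r) (suc ℓ) =
    +-mono-≤ (level≤2^ l ℓ) (≤-trans (level≤2^ r ℓ) (≤-reflexive (sym (+-identityʳ _))))

  level≤maxLevel : ∀ (t : Tree S) {k ℓ} → ℓ ≤ k → level t ℓ ≤ maxLevel t k
  level≤maxLevel t {zero}  z≤n = ≤-refl
  level≤maxLevel t {suc k} {ℓ} ℓ≤1+k with ℓ ≤? k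
  ... | yes ℓ≤k = ≤-trans (level≤maxLevel t ℓ≤k) (m≤m⊔n _ _)
  ... | no ℓ≰k rewrite ≤-antisym ℓ≤1+k (≰⇒> ℓ≰k) = m≤n⊔m _ _

  level≤thickness : ∀ (t : Tree S) ℓ → level t ℓ ≤ thickness t
  level≤thickness t ℓ with ℓ ≤? height t
  ... | yes ℓ≤h = level≤maxLevel t ℓ≤h
  ... | no ℓ≰h rewrite level-≡0 t (≰⇒> ℓ≰h) = z≤n

  maxLevel-attained : ∀ (t : Tree S) k → ∃[ ℓ ] maxLevel t k ≡ level t ℓ
  maxLevel-attained t zero    = zero , refl
  maxLevel-attained t (suc k) with ⊔-sel (maxLevel t k) (level t (suc k))
  ... | inj₁ eq = let ℓ , eq′ = maxLevel-attained t k in ℓ , trans eq eq′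
  ... | inj₂ eq = suc k , eq

  -- As when t is a subtree of t′ at depth k.
  record EmbedsAt (k : ℕ) (t t′ : Tree S) : Set where
    constructor mkEmbedsAt
    field level-shift : ∀ ℓ → level t ℓ ≤ level t′ (k + ℓ)
  open EmbedsAt public

  EmbedsAt-refl : ∀ {t} → EmbedsAt 0 t t
  EmbedsAt-refl = mkEmbedsAt λ ℓ → ≤-refl

  EmbedsAt-trans : ∀ {j k t t′ t″} → EmbedsAt j t t′ → EmbedsAt k t′ t″ → EmbedsAt (k + j) t t″
  EmbedsAt-trans {j} {k} {t″ = t″} t⊑t′ t′⊑t″ = mkEmbedsAt λ ℓ →
    ≤-trans (level-shift t⊑t′ ℓ)
      (≤-trans (level-shift t′⊑t″ (j + ℓ)) (≤-reflexive (cong (level t″) (sym (+-assoc k j ℓ)))))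

  EmbedsAt-nodeˡ : ∀ {a l r} → EmbedsAt 1 l (node a l r)
  EmbedsAt-nodeˡ = mkEmbedsAt λ ℓ → m≤m+n _ _

  EmbedsAt-nodeʳ : ∀ {a l r} → EmbedsAt 1 r (node a l r)
  EmbedsAt-nodeʳ = mkEmbedsAt λ ℓ → m≤n+m _ _

  EmbedsAt⇒height : ∀ {k t t′} → EmbedsAt k t t′ → k + height t ≤ height t′
  EmbedsAt⇒height {k} {t} {t′} t⊑t′ =
    ≮⇒≥ λ h<k+h → <-irrefl refl (≤-trans (level-pos t ≤-refl)
                                   (≤-trans (level-shift t⊑t′ (height t)) (≤-reflexive (level-≡0 t′ h<k+h))))

  -- Every level of t has at most 2 ^ (m ∸ 1) positions, doubled to avoid truncated subtraction.
  record Thin (m : ℕ) (t : Tree S) : Set where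
    constructor mkThin
    field level-bound : ∀ ℓ → 2 * level t ℓ ≤ 2 ^ m
  open Thin public

  Thin-mono : ∀ {m m′ t} → m ≤ m′ → Thin m t → Thin m′ t
  Thin-mono m≤m′ thin = mkThin λ ℓ → ≤-trans (level-bound thin ℓ) (^-monoʳ-≤ 2 m≤m′)

  thin⇒thickness≤ : ∀ {m t} → Thin m t → thickness t ≤ 2 ^ (m ∸ 1)
  thin⇒thickness≤ {zero} {leaf _}     thin = contradiction (level-bound thin 0) λ { (s≤s ()) }
  thin⇒thickness≤ {zero} {node _ _ _} thin = contradiction (level-bound thin 0) λ { (s≤s ()) }
  thin⇒thickness≤ {suc m} {t} thin with maxLevel-attained t (height t)
  ... | ℓ , eq rewrite eq = *-cancelˡ-≤ 2 (level-bound thin ℓ)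

  thin-if-deep : ∀ {m t} → (∀ ℓ → m < ℓ → 2 * level t ℓ ≤ 2 ^ suc m) → Thin (suc m) t
  thin-if-deep {m} {t} deep = mkThin bound
    where
    bound : ∀ ℓ → 2 * level t ℓ ≤ 2 ^ suc m
    bound ℓ with ℓ ≤? m
    ... | yes ℓ≤m = *-monoʳ-≤ 2 (≤-trans (level≤2^ t ℓ) (^-monoʳ-≤ 2 ℓ≤m))
    ... | no ℓ≰m = deep ℓ (≰⇒> ℓ≰m)

  thin-leaf : ∀ {m a} → Thin (suc m) (leaf a)
  thin-leaf = thin-if-deep λ { zero () ; (suc ℓ) _ → z≤n }

  thin-node : ∀ {m₁ m₂ a l r} → Thin m₁ l → Thin m₂ r → Thin (suc (m₁ ⊔ m₂)) (node a l r)
  thin-node {m₁} {m₂} {a} {l} {r} thinˡ thinʳ = thin-if-deep λ where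
    zero ()
    (suc ℓ) _ → begin
      2 * (level l ℓ + level r ℓ)    ≡⟨ *-distribˡ-+ 2 (level l ℓ) (level r ℓ) ⟩
      2 * level l ℓ + 2 * level r ℓ  ≤⟨ +-mono-≤ (level-bound (Thin-mono (m≤m⊔n m₁ m₂) thinˡ) ℓ)
                                                 (level-bound (Thin-mono (m≤n⊔m m₁ m₂) thinʳ) ℓ) ⟩
      2 ^ (m₁ ⊔ m₂) + 2 ^ (m₁ ⊔ m₂)  ≡⟨ cong (2 ^ (m₁ ⊔ m₂) +_) (sym (+-identityʳ _)) ⟩
      2 ^ suc (m₁ ⊔ m₂)              ∎

  thin-node-shortʳ : ∀ {m a l r} → Thin m l → suc (height r) < m → Thin m (node a l r)
  thin-node-shortʳ {suc m} {a} {l} {r} thin (s≤s r<m) = thin-if-deep λ where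
    zero ()
    (suc ℓ) (s≤s m≤ℓ) → begin
      2 * (level l ℓ + level r ℓ)  ≡⟨ cong (λ k → 2 * (level l ℓ + k)) (level-≡0 r (<-≤-trans r<m m≤ℓ)) ⟩
      2 * (level l ℓ + 0)          ≡⟨ cong (2 *_) (+-identityʳ (level l ℓ)) ⟩
      2 * level l ℓ                ≤⟨ level-bound thin ℓ ⟩
      2 ^ suc m                    ∎

  thin-node-shortˡ : ∀ {m a l r} → suc (height l) < m → Thin m r → Thin m (node a l r)
  thin-node-shortˡ {suc m} {a} {l} {r} (s≤s l<m) thin = thin-if-deep λ where
    zero ()
    (suc ℓ) (s≤s m≤ℓ) → begin
      2 * (level l ℓ + level r ℓ)  ≡⟨ cong (λ k → 2 * (k + level r ℓ)) (level-≡0 l (<-≤-trans l<m m≤ℓ)) ⟩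
      2 * level r ℓ                ≤⟨ level-bound thin ℓ ⟩
      2 ^ suc m                    ∎

  height-bound : ∀ (ts : List (Tree S)) → ∃[ H ] (∀ {t} → t ∈ₗ ts → height t < H)
  height-bound []       = 0 , λ ()
  height-bound (t ∷ ts) = let H , bound = height-bound ts in
    suc (height t) ⊔ H , λ { (here refl) → m≤m⊔n (suc (height t)) H ; (there t∈ts) → ≤-trans (bound t∈ts) (m≤n⊔m _ _) }

  unbounded⇒Infinite : ∀ {P} → (∀ H → ∃[ t ] (P t × H ≤ height t)) → Infinite P
  unbounded⇒Infinite tall (ts , cover) =
    let H , bound = height-bound ts
        t , pt , H≤ = tall H
    in <⇒≱ (bound (cover t pt)) H≤

module _ {s : ℕ} where

  treesOfHeight≤ : ℕ → List (Tree (Fin s))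
  treesOfHeight≤ zero    = map leaf (allFin s)
  treesOfHeight≤ (suc h) =
    map leaf (allFin s) ++ cartesianProductWith (λ a → uncurry (node a)) (allFin s) (cartesianProduct ts ts)
    where ts = treesOfHeight≤ h

  ∈-treesOfHeight≤ : ∀ {h} t → height t ≤ h → t ∈ₗ treesOfHeight≤ h
  ∈-treesOfHeight≤ {zero}  (leaf a)     _       = ∈-map⁺ leaf (∈-allFin a)
  ∈-treesOfHeight≤ {suc h} (leaf a)     _       = ∈-++⁺ˡ (∈-map⁺ leaf (∈-allFin a))
  ∈-treesOfHeight≤ {suc h} (node a l r) (s≤s p) =
    ∈-++⁺ʳ _ (∈-cartesianProductWith⁺ (λ a → uncurry (node a)) (∈-allFin a)
      (∈-cartesianProduct⁺ (∈-treesOfHeight≤ l (≤-trans (m≤m⊔n _ _) p))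
                           (∈-treesOfHeight≤ r (≤-trans (m≤n⊔m _ _) p))))

  bounded⇒¬Infinite : ∀ {P h} → (∀ t → P t → height t ≤ h) → ¬ Infinite P
  bounded⇒¬Infinite bound inf = inf (_ , λ t pt → ∈-treesOfHeight≤ t (bound t pt))

toSubset : ∀ {n} {P : Fin n → Set} → (∀ x → Dec (P x)) → Subset n
toSubset {zero}  P? = []
toSubset {suc n} P? = does (P? zero) ∷ toSubset (P? ∘ suc)

∈-toSubset⁺ : ∀ {n} {P : Fin n → Set} (P? : ∀ x → Dec (P x)) {x} → P x → x ∈ toSubset P?
∈-toSubset⁺ P? {zero} px with P? zero
... | yes _  = here
... | no ¬px = contradiction px ¬px
∈-toSubset⁺ P? {suc x} px = there (∈-toSubset⁺ (P? ∘ suc) px)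

∈-toSubset⁻ : ∀ {n} {P : Fin n → Set} (P? : ∀ x → Dec (P x)) {x} → x ∈ toSubset P? → P x
∈-toSubset⁻ P? {zero} x∈ with P? zero
... | yes px = px
... | no _   = contradiction x∈ λ ()
∈-toSubset⁻ P? {suc x} (there x∈) = ∈-toSubset⁻ (P? ∘ suc) x∈

increasing-chain-stalls : ∀ {n} (S : ℕ → Subset n) → (∀ k → S k ⊆ S (suc k)) → ∃[ k ] (S (suc k) ⊆ S k)
increasing-chain-stalls {n} S increasing with grows-or-stalls (suc n)
  where
  grows-or-stalls : ∀ j → j ≤ ∣ S j ∣ ⊎ ∃[ k ] (S (suc k) ⊆ S k)
  grows-or-stalls zero = inj₁ z≤n
  grows-or-stalls (suc j) with grows-or-stalls j
  ... | inj₂ stall = inj₂ stall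
  ... | inj₁ j≤∣S∣ with S j ⊂? S (suc j)
  ...   | yes S⊂ = inj₁ (≤-<-trans j≤∣S∣ (p⊂q⇒∣p∣<∣q∣ S⊂))
  ...   | no S⊄  = inj₂ (j , λ {x} x∈ →
            decidable-stable (x ∈? S j) λ x∉ → S⊄ (increasing j , x , x∈ , x∉))
... | inj₁ n<∣S∣ = ⊥-elim (<⇒≱ n<∣S∣ (∣p∣≤n (S (suc n))))
... | inj₂ stall = stall

module _ {n : ℕ} {R : Fin n → Fin n → Set} (R? : ∀ x y → Dec (R x y)) where

  Within : ℕ → Fin n → Fin n → Set
  Within zero    x y = x ≡ y
  Within (suc k) x y = Within k x y ⊎ ∃[ z ] (R x z × Within k z y)

  Within? : ∀ k x y → Dec (Within k x y)
  Within? zero    x y = x ≟ y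
  Within? (suc k) x y = Within? k x y ⊎-dec any? λ z → R? x z ×-dec Within? k z y

  Within⇒Star : ∀ k {x y} → Within k x y → Star R x y
  Within⇒Star zero    refl               = ε
  Within⇒Star (suc k) (inj₁ w)           = Within⇒Star k w
  Within⇒Star (suc k) (inj₂ (_ , e , w)) = e ◅ Within⇒Star k w

  Within-refl : ∀ k {y} → Within k y y
  Within-refl zero    = refl
  Within-refl (suc k) = inj₁ (Within-refl k)

  Star⇒Within : ∀ {k y} → (∀ {x} → Within (suc k) x y → Within k x y) → ∀ {x} → Star R x y → Within k x y
  Star⇒Within {k} stalled ε       = Within-refl k
  Star⇒Within     stalled (e ◅ π) = stalled (inj₂ (_ , e , Star⇒Within stalled π))

  -- The sets {x ∣ Within k x y} increase with k, so they stall, and a stalled one contains every path.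
  star? : ∀ x y → Dec (Star R x y)
  star? x y with increasing-chain-stalls (λ k → toSubset (λ z → Within? k z y))
                   (λ k → ∈-toSubset⁺ _ ∘ inj₁ ∘ ∈-toSubset⁻ _)
  ... | k , stalled =
    map′ (Within⇒Star k) (Star⇒Within (∈-toSubset⁻ _ ∘ stalled ∘ ∈-toSubset⁺ _)) (Within? k x y)

module _ {s n : ℕ} (A : Automaton s n) where
  open Automaton A

  edgeˡ : ∀ a l r → Edge A (run A l) (run A (node a l r))
  edgeˡ a l r = a , run A r , inj₁ refl

  edgeʳ : ∀ a l r → Edge A (run A r) (run A (node a l r))
  edgeʳ a l r = a , run A l , inj₂ refl

  CycleReaches : Fin n → Set
  CycleReaches y = ∃[ x ] ∃[ z ] (Edge A x z × Reach A z x × Reach A x y)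

  SpecialCycleReaches : Fin n → Set
  SpecialCycleReaches y = ∃[ p ] ∃[ q ] (Special A p q × Reach A q p × Reach A p y)

  CycleReaches-step : ∀ {x y} → CycleReaches x → Edge A x y → CycleReaches y
  CycleReaches-step (u , v , e , π , ρ) e′ = u , v , e , π , ρ ◅◅ e′ ◅ ε

  SpecialCycleReaches-step : ∀ {x y} → SpecialCycleReaches x → Edge A x y → SpecialCycleReaches y
  SpecialCycleReaches-step (p , q , sp , π , ρ) e = p , q , sp , π , ρ ◅◅ e ◅ ε

  Edge? : ∀ p q → Dec (Edge A p q)
  Edge? p q = any? λ a → any? λ r → (δ a p r ≟ q) ⊎-dec (δ a r p ≟ q)

  Reach? : ∀ p q → Dec (Reach A p q)
  Reach? = star? Edge?

  CycleReaches? : ∀ y → Dec (CycleReaches y)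
  CycleReaches? y = any? λ x → any? λ z → Edge? x z ×-dec Reach? z x ×-dec Reach? x y

  states : Tree (Fin s) → Subset n
  states (leaf a)     = ⁅ ι a ⁆
  states (node a l r) = ⁅ run A (node a l r) ⁆ ∪ (states l ∪ states r)

  run∈states : ∀ t → run A t ∈ states t
  run∈states (leaf a)     = x∈⁅x⁆ _
  run∈states (node a l r) = x∈p∪q⁺ (inj₁ (x∈⁅x⁆ _))

  statesˡ⊆ : ∀ a l r → states l ⊆ states (node a l r)
  statesˡ⊆ a l r q∈ = x∈p∪q⁺ (inj₂ (x∈p∪q⁺ (inj₁ q∈)))

  statesʳ⊆ : ∀ a l r → states r ⊆ states (node a l r)
  statesʳ⊆ a l r q∈ = x∈p∪q⁺ (inj₂ (x∈p∪q⁺ (inj₂ q∈)))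

  ∈states⇒Reach : ∀ t {q} → q ∈ states t → Reach A q (run A t)
  ∈states⇒Reach (leaf a) q∈ rewrite x∈⁅y⁆⇒x≡y _ q∈ = ε
  ∈states⇒Reach (node a l r) q∈ with x∈p∪q⁻ _ _ q∈
  ... | inj₁ q∈root rewrite x∈⁅y⁆⇒x≡y _ q∈root = ε
  ... | inj₂ q∈lr with x∈p∪q⁻ _ _ q∈lr
  ...   | inj₁ q∈l = ∈states⇒Reach l q∈l ◅◅ edgeˡ a l r ◅ ε
  ...   | inj₂ q∈r = ∈states⇒Reach r q∈r ◅◅ edgeʳ a l r ◅ ε

  repeatsˡ-or-fewer : ∀ a l r → run A (node a l r) ∈ states l ⊎ ∣ states l ∣ < ∣ states (node a l r) ∣
  repeatsˡ-or-fewer a l r with run A (node a l r) ∈? states l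
  ... | yes q∈l = inj₁ q∈l
  ... | no q∉l  = inj₂ (p⊂q⇒∣p∣<∣q∣ (statesˡ⊆ a l r , _ , run∈states (node a l r) , q∉l))

  repeatsʳ-or-fewer : ∀ a l r → run A (node a l r) ∈ states r ⊎ ∣ states r ∣ < ∣ states (node a l r) ∣
  repeatsʳ-or-fewer a l r with run A (node a l r) ∈? states r
  ... | yes q∈r = inj₁ q∈r
  ... | no q∉r  = inj₂ (p⊂q⇒∣p∣<∣q∣ (statesʳ⊆ a l r , _ , run∈states (node a l r) , q∉r))

  loopˡ : ∀ a l r → run A (node a l r) ∈ states l → CycleReaches (run A l)
  loopˡ a l r q∈l = _ , _ , edgeˡ a l r , ∈states⇒Reach l q∈l , ε

  loopʳ : ∀ a l r → run A (node a l r) ∈ states r → CycleReaches (run A r)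
  loopʳ a l r q∈r = _ , _ , edgeʳ a l r , ∈states⇒Reach r q∈r , ε

  cycle-or-short : ∀ t → CycleReaches (run A t) ⊎ height t < ∣ states t ∣
  cycle-or-short (leaf a) = inj₂ (≤-reflexive (sym (∣⁅x⁆∣≡1 (ι a))))
  cycle-or-short (node a l r) with repeatsˡ-or-fewer a l r | repeatsʳ-or-fewer a l r
  ... | inj₁ q∈l | _        = inj₁ (CycleReaches-step (loopˡ a l r q∈l) (edgeˡ a l r))
  ... | inj₂ _   | inj₁ q∈r = inj₁ (CycleReaches-step (loopʳ a l r q∈r) (edgeʳ a l r))
  ... | inj₂ fewerˡ | inj₂ fewerʳ with cycle-or-short l | cycle-or-short r
  ...   | inj₁ cyc    | _           = inj₁ (CycleReaches-step cyc (edgeˡ a l r))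
  ...   | inj₂ _      | inj₁ cyc    = inj₁ (CycleReaches-step cyc (edgeʳ a l r))
  ...   | inj₂ shortˡ | inj₂ shortʳ = inj₂ (⊔-lub (≤-<-trans shortˡ fewerˡ) (≤-<-trans shortʳ fewerʳ))

  InfRun⇒CycleReaches : ∀ {y} → InfRun A y → CycleReaches y
  InfRun⇒CycleReaches {y} inf = decidable-stable (CycleReaches? y) λ ¬cyc →
    bounded⇒¬Infinite (short ¬cyc) inf
    where
    short : ¬ CycleReaches y → ∀ t → run A t ≡ y → height t ≤ n
    short ¬cyc t refl with cycle-or-short t
    ... | inj₁ cyc        = contradiction cyc ¬cyc
    ... | inj₂ h<∣states∣ = <⇒≤ (<-≤-trans h<∣states∣ (∣p∣≤n (states t)))

  module _ (reduced : Reduced A) where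

    witness : Fin n → Tree (Fin s)
    witness q = proj₁ (reduced q)

    witness-run : ∀ q → run A (witness q) ≡ q
    witness-run q = proj₂ (reduced q)

    plant-edge : ∀ {p q} → Edge A p q → ∀ t → run A t ≡ p → ∃[ t′ ] (run A t′ ≡ q × EmbedsAt 1 t t′)
    plant-edge (a , r , inj₁ δ≡q) t refl =
      node a t (witness r) , trans (cong (δ a (run A t)) (witness-run r)) δ≡q , EmbedsAt-nodeˡ
    plant-edge (a , r , inj₂ δ≡q) t refl =
      node a (witness r) t , trans (cong (λ x → δ a x (run A t)) (witness-run r)) δ≡q , EmbedsAt-nodeʳ

    plant : ∀ {p q} → Reach A p q → ∀ t → run A t ≡ p → ∃[ k ] ∃[ t′ ] (run A t′ ≡ q × EmbedsAt k t t′)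
    plant ε       t t↦p = 0 , t , t↦p , EmbedsAt-refl
    plant (e ◅ π) t t↦p =
      let t₁ , t₁↦ , t⊑t₁ = plant-edge e t t↦p
          k , t₂ , t₂↦ , t₁⊑t₂ = plant π t₁ t₁↦
      in k + 1 , t₂ , t₂↦ , EmbedsAt-trans t⊑t₁ t₁⊑t₂

    pump : ∀ {x z} → Edge A x z → Reach A z x → ∀ H → ∃[ t ] (run A t ≡ x × H ≤ height t)
    pump {x} _ _ zero = witness x , witness-run x , z≤n
    pump e π (suc H) =
      let t , t↦x , H≤ = pump e π H
          t₁ , t₁↦ , t⊑t₁ = plant-edge e t t↦x
          k , t₂ , t₂↦ , t₁⊑t₂ = plant π t₁ t₁↦
          open ≤-Reasoning
      in t₂ , t₂↦ , (begin
        suc H          ≤⟨ s≤s H≤ ⟩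
        1 + height t   ≤⟨ EmbedsAt⇒height t⊑t₁ ⟩
        height t₁      ≤⟨ m≤n+m (height t₁) k ⟩
        k + height t₁  ≤⟨ EmbedsAt⇒height t₁⊑t₂ ⟩
        height t₂      ∎)

    tall : ∀ {y} → CycleReaches y → ∀ H → ∃[ t ] (run A t ≡ y × H ≤ height t)
    tall (x , z , e , π , ρ) H =
      let t , t↦x , H≤ = pump e π H
          k , t′ , t′↦y , t⊑t′ = plant ρ t t↦x
      in t′ , t′↦y , ≤-trans H≤ (≤-trans (m≤n+m _ k) (EmbedsAt⇒height t⊑t′))

    CycleReaches⇒InfRun : ∀ {y} → CycleReaches y → InfRun A y
    CycleReaches⇒InfRun = unbounded⇒Infinite ∘ tall

    InfRun? : ∀ y → Dec (InfRun A y)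
    InfRun? y = map′ CycleReaches⇒InfRun InfRun⇒CycleReaches (CycleReaches? y)

    SpecialCycleToF? : Dec (SpecialCycleToF A)
    SpecialCycleToF? = any? λ p → any? λ q → any? λ f →
      Special? p q ×-dec Reach? q p ×-dec (f ∈? F) ×-dec Reach? p f
      where
      Special? : ∀ p q → Dec (Special A p q)
      Special? p q = any? λ a → any? λ r → ((δ a p r ≟ q) ⊎-dec (δ a r p ≟ q)) ×-dec InfRun? r

    specialˡ : ∀ a l r → run A (node a l r) ∈ states l → CycleReaches (run A r) →
               SpecialCycleReaches (run A (node a l r))
    specialˡ a l r q∈l cyc =
      _ , _ , (a , run A r , inj₁ refl , CycleReaches⇒InfRun cyc) , ∈states⇒Reach l q∈l , edgeˡ a l r ◅ ε

    specialʳ : ∀ a l r → run A (node a l r) ∈ states r → CycleReaches (run A l) →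
               SpecialCycleReaches (run A (node a l r))
    specialʳ a l r q∈r cyc =
      _ , _ , (a , run A l , inj₂ refl , CycleReaches⇒InfRun cyc) , ∈states⇒Reach r q∈r , edgeʳ a l r ◅ ε

    special-or-thin : ∀ t → SpecialCycleReaches (run A t) ⊎ Thin ∣ states t ∣ t
    special-or-thin (leaf a) = inj₂ (Thin-mono (≤-reflexive (sym (∣⁅x⁆∣≡1 (ι a)))) thin-leaf)
    special-or-thin (node a l r) with repeatsˡ-or-fewer a l r | repeatsʳ-or-fewer a l r
    ... | inj₁ q∈l | inj₁ q∈r = inj₁ (specialˡ a l r q∈l (loopʳ a l r q∈r))
    ... | inj₁ q∈l | inj₂ fewerʳ with cycle-or-short r | special-or-thin l
    ...   | inj₁ cyc    | _          = inj₁ (specialˡ a l r q∈l cyc)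
    ...   | inj₂ _      | inj₁ sp    = inj₁ (SpecialCycleReaches-step sp (edgeˡ a l r))
    ...   | inj₂ shortʳ | inj₂ thinˡ =
      inj₂ (thin-node-shortʳ (Thin-mono (p⊆q⇒∣p∣≤∣q∣ (statesˡ⊆ a l r)) thinˡ) (≤-<-trans shortʳ fewerʳ))
    special-or-thin (node a l r) | inj₂ fewerˡ | inj₁ q∈r with cycle-or-short l | special-or-thin r
    ...   | inj₁ cyc    | _          = inj₁ (specialʳ a l r q∈r cyc)
    ...   | inj₂ _      | inj₁ sp    = inj₁ (SpecialCycleReaches-step sp (edgeʳ a l r))
    ...   | inj₂ shortˡ | inj₂ thinʳ =
      inj₂ (thin-node-shortˡ (≤-<-trans shortˡ fewerˡ) (Thin-mono (p⊆q⇒∣p∣≤∣q∣ (statesʳ⊆ a l r)) thinʳ))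
    special-or-thin (node a l r) | inj₂ fewerˡ | inj₂ fewerʳ with special-or-thin l | special-or-thin r
    ...   | inj₁ sp    | _          = inj₁ (SpecialCycleReaches-step sp (edgeˡ a l r))
    ...   | inj₂ _     | inj₁ sp    = inj₁ (SpecialCycleReaches-step sp (edgeʳ a l r))
    ...   | inj₂ thinˡ | inj₂ thinʳ = inj₂ (Thin-mono (⊔-lub fewerˡ fewerʳ) (thin-node thinˡ thinʳ))

    thick⇒cycle : ThickWitness A → SpecialCycleToF A
    thick⇒cycle (t , t∈L , thick) with special-or-thin t
    ... | inj₁ (p , q , sp , q⇝p , p⇝t) = p , q , run A t , sp , q⇝p , t∈L , p⇝t
    ... | inj₂ thin = contradiction (thin⇒thickness≤ (Thin-mono (∣p∣≤n (states t)) thin)) (<⇒≱ thick)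

    beside : ∀ {a p q r j} → (δ a p r ≡ q ⊎ δ a r p ≡ q) → ∀ u v → run A u ≡ p → run A v ≡ r → j ≤ height v →
             ∃[ w ] (run A w ≡ q × level u j < level w (suc j))
    beside {a} {j = j} (inj₁ δ≡q) u v refl refl j≤h = node a u v , δ≡q , m<m+n (level u j) (level-pos v j≤h)
    beside {a} {j = j} (inj₂ δ≡q) u v refl refl j≤h = node a v u , δ≡q , m<n+m (level u j) (level-pos v j≤h)

    thick-at : ∀ {a p q r} → (δ a p r ≡ q ⊎ δ a r p ≡ q) → CycleReaches r → Reach A q p →
               ∀ K → ∃[ t ] ∃[ ℓ ] (run A t ≡ q × K ≤ level t ℓ)
    thick-at {q = q} _ _ _ zero = witness q , 0 , witness-run q , z≤n
    thick-at δ≡q cyc q⇝p (suc K) =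
      let t , ℓ , t↦q , K≤ = thick-at δ≡q cyc q⇝p K
          k , u , u↦p , t⊑u = plant q⇝p t t↦q
          v , v↦r , high = tall cyc (k + ℓ)
          w , w↦q , u<w = beside δ≡q u v u↦p v↦r high
      in w , suc (k + ℓ) , w↦q , ≤-<-trans (≤-trans K≤ (level-shift t⊑u ℓ)) u<w

    arbitrarily-thick : SpecialCycleToF A → ∀ K → ∃[ t ] (Lang A t × K ≤ thickness t)
    arbitrarily-thick (p , q , f , (a , r , δ≡q , inf) , q⇝p , f∈F , p⇝f) K =
      let t , ℓ , t↦q , K≤ = thick-at δ≡q (InfRun⇒CycleReaches inf) q⇝p K
          k , u , u↦f , t⊑u = plant (q⇝p ◅◅ p⇝f) t t↦q
      in u , subst (_∈ F) (sym u↦f) f∈F , ≤-trans K≤ (≤-trans (level-shift t⊑u ℓ) (level≤thickness u (k + ℓ)))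

    cycle⇒thick : SpecialCycleToF A → ThickWitness A
    cycle⇒thick sc = arbitrarily-thick sc (suc (2 ^ (n ∸ 1)))

    cycle⇒fat : SpecialCycleToF A → Fat (Lang A)
    cycle⇒fat sc (K , _ , bounded) =
      let t , t∈L , K<thickness = arbitrarily-thick sc (suc K) in <⇒≱ K<thickness (bounded t t∈L)

    fat⇒cycle : Fat (Lang A) → SpecialCycleToF A
    fat⇒cycle fat = decidable-stable SpecialCycleToF? λ ¬sc →
      fat (2 ^ (n ∸ 1) , m^n>0 2 (n ∸ 1) , λ t t∈L → ≮⇒≥ λ thick → ¬sc (thick⇒cycle (t , t∈L , thick)))

lemma3p4 : ∀ {s n : ℕ} (A : Automaton s n) → Reduced A →
             (Fat (Lang A) ⇔ ThickWitness A) × (ThickWitness A ⇔ SpecialCycleToF A)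
lemma3p4 A reduced =
  mk⇔ (cycle⇒thick A reduced ∘ fat⇒cycle A reduced) (cycle⇒fat A reduced ∘ thick⇒cycle A reduced) ,
  mk⇔ (thick⇒cycle A reduced) (cycle⇒thick A reduced)
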